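{- Let \(k\ge2\) be an integer. No full-rank integral lattice \(\mathcal L\subset\mathbb R^2\) satisfies \(N_{=k}(\mathcal L)=2\binom{2k}{2k-1}=4k\).
   Context: A lattice \(\mathcal L\subset\mathbb R^2\) is integral if \(\langle x,y\rangle\in\mathbb Z\) for all \(x,y\in\mathcal L\). \(N_{=k}(\mathcal L)\) denotes the number of \(y\in\mathcal L\) with \(\|y\|^2=k\). -}

module Defs where

open import Data.Nat using (ℕ)
open import Data.Integer using (ℤ; _+_; _*_; _-_; _<_; +_; 0ℤ)
open import Data.Product using (_×_; _,_; Σ-syntax)
open import Data.List using (List; length)
open import Data.List.Membership.Propositional using (_∈_)
open import Data.List.Relation.Unary.Unique.Propositional using (Unique)
open import Relation.Binary.PropositionalEquality using (_≡_)
open import Function.Bundles using (_⇔_)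

-- A full-rank integral lattice in ℝ², up to isometry, is given by the Gram
-- matrix [[a , b] , [b , c]] of a basis: integer entries (integrality) and
-- positive definite (full rank: basis vectors linearly independent).
record IntegralLattice2 : Set where
  field
    a b c   : ℤ
    a-pos   : 0ℤ < a
    det-pos : 0ℤ < a * c - b * b

open IntegralLattice2 public

-- Lattice vectors written in coordinates (x , y) w.r.t. the basis.
Vec2 : Set
Vec2 = ℤ × ℤ

normSq : IntegralLattice2 → Vec2 → ℤ
normSq L (x , y) = a L * x * x + (+ 2) * b L * x * y + c L * y * y

N= : IntegralLattice2 → ℕ → ℕ → Set
N= L k n = Σ[ l ∈ List Vec2 ] (Unique l × length l ≡ n
             × (∀ v → (v ∈ l) ⇔ (normSq L v ≡ + k)))

-- Fix u with ‖u‖² = k. Lagrange's identity ‖u‖²‖v‖² = ⟨u,v⟩² + Δ·det(u,v)², with Δ > 0 the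
-- Gram determinant, shows that every v with ‖v‖² = k satisfies ⟨u,v⟩² + Δ·det(u,v)² = k².
-- Hence ⟨u,v⟩ ∈ [-k, k], det(u,v) = 0 when ⟨u,v⟩ = ±k, and v is determined by ⟨u,v⟩ together
-- with the sign of det(u,v): at most 4k vectors. One of these 4k positions is always empty,
-- because ⟨u,v⟩ = 0 and ⟨u,w⟩ = 1 cannot both occur: Δ would divide both k² and k² - 1,
-- forcing Δ = 1 and k² - 1 to be a square.
module Submission where

open import Defs
open import Data.Nat using (ℕ; zero; suc; _+_; _*_; _∸_; _≤_; _<_; s≤s; z≤n; z<s; NonZero; >-nonZero; >-nonZero⁻¹)
import Data.Nat.Properties as ℕ
open import Data.Nat.Combinatorics using (_C_; nCk≡nC[n∸k]; nC1≡n)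
open import Data.Nat.Divisibility using (_∣_; ∣1⇒≡1; ∣m+n∣m⇒∣n; m∣m*n)
import Data.Nat.Tactic.RingSolver as ℕ-Solver
open import Data.Integer using (ℤ; +_; -[1+_]; ∣_∣; sign; _◃_; 0ℤ; 1ℤ)
  renaming (_+_ to _+ᶻ_; _*_ to _*ᶻ_; _-_ to _-ᶻ_; _<_ to _<ᶻ_; _≟_ to _≟ᶻ_; NonZero to NonZeroᶻ)
import Data.Integer.Properties as ℤ
import Data.Integer.Tactic.RingSolver as ℤ-Solver
open import Data.Sign using (Sign)
open import Data.Sign.Properties using (s*s≡+)
open import Data.Fin using (Fin; zero; suc; toℕ; fromℕ<; punchOut)
import Data.Fin.Properties as Fin
open import Data.List using (List; []; _∷_; length; lookup)
open import Data.List.Relation.Unary.Unique.Propositional using (Unique)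
open import Data.List.Relation.Unary.AllPairs using (_∷_)
import Data.List.Relation.Unary.All as All
open import Data.List.Relation.Unary.Any using (here; any?)
open import Data.List.Membership.Propositional using (_∈_; find; lose)
open import Data.List.Membership.Propositional.Properties using (∈-lookup)
open import Data.Product using (_×_; _,_; proj₁; proj₂; ∃-syntax)
open import Function.Base using (it)
open import Function.Bundles using (Equivalence)
open import Function.Definitions using (Injective)
open import Relation.Nullary using (¬_; yes; no; contradiction)
open import Relation.Binary.PropositionalEquality

InjectiveOn : ∀ {A B : Set} → List A → (A → B) → Set
InjectiveOn xs f = ∀ {x y} → x ∈ xs → y ∈ xs → f x ≡ f y → x ≡ y

lookup-injective : ∀ {A : Set} {xs : List A} → Unique xs → Injective _≡_ _≡_ (lookup xs)
lookup-injective {xs = _ ∷ _}  (_    ∷ xs!) {zero}  {zero}  _  = refl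
lookup-injective {xs = _ ∷ xs} (x∉xs ∷ _)   {zero}  {suc j} eq =
  contradiction eq (All.lookup x∉xs (∈-lookup {xs = xs} j))
lookup-injective {xs = _ ∷ xs} (x∉xs ∷ _)   {suc i} {zero}  eq =
  contradiction (sym eq) (All.lookup x∉xs (∈-lookup {xs = xs} i))
lookup-injective {xs = _ ∷ _}  (_    ∷ xs!) {suc i} {suc j} eq = cong suc (lookup-injective xs! eq)

injection-missing-value⇒length< : ∀ {A : Set} {xs : List A} {n p : ℕ} (f : A → ℕ) →
  Unique xs → InjectiveOn xs f → (∀ {x} → x ∈ xs → f x < n) →
  p < n → (∀ {x} → x ∈ xs → f x ≢ p) → length xs < n
injection-missing-value⇒length< {xs = xs} {suc n} {p} f xs! f-injective f<n p<n f≢p =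
  s≤s (Fin.injective⇒≤ punchOut-code-injective)
  where
  code : Fin (length xs) → Fin (suc n)
  code i = fromℕ< (f<n (∈-lookup i))

  p≢code : ∀ i → fromℕ< p<n ≢ code i
  p≢code i eq = f≢p (∈-lookup i) (begin
    f (lookup xs i)   ≡⟨ Fin.toℕ-fromℕ< _ ⟨
    toℕ (code i)      ≡⟨ cong toℕ eq ⟨
    toℕ (fromℕ< p<n)  ≡⟨ Fin.toℕ-fromℕ< p<n ⟩
    p                 ∎)
    where open ≡-Reasoning

  punchOut-code-injective : Injective _≡_ _≡_ (λ i → punchOut (p≢code i))
  punchOut-code-injective eq = lookup-injective xs!
    (f-injective (∈-lookup _) (∈-lookup _)
      (Fin.fromℕ<-injective _ _ _ _ (Fin.punchOut-injective (p≢code _) (p≢code _) eq)))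

m*m≤n*n⇒m≤n : ∀ {m n} → m * m ≤ n * n → m ≤ n
m*m≤n*n⇒m≤n m*m≤n*n = ℕ.≮⇒≥ (λ n<m → ℕ.<⇒≱ (ℕ.*-mono-< n<m n<m) m*m≤n*n)

m*m<n*n⇒m<n : ∀ {m n} → m * m < n * n → m < n
m*m<n*n⇒m<n m*m<n*n = ℕ.≰⇒> (λ n≤m → ℕ.<⇒≱ m*m<n*n (ℕ.*-mono-≤ n≤m n≤m))

m*m≡n*n⇒m≡n : ∀ {m n} → m * m ≡ n * n → m ≡ n
m*m≡n*n⇒m≡n eq = ℕ.≤-antisym (m*m≤n*n⇒m≤n (ℕ.≤-reflexive eq)) (m*m≤n*n⇒m≤n (ℕ.≤-reflexive (sym eq)))

n*n≡m*m+1⇒m≡0 : ∀ {m n} → n * n ≡ m * m + 1 → m ≡ 0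
n*n≡m*m+1⇒m≡0 {m} {n} eq = ℕ.n≤0⇒n≡0 (ℕ.m+n≤o⇒m≤o m (ℕ.+-cancelˡ-≤ (m * m + 1) _ _ (begin
  m * m + 1 + (m + m)  ≡⟨ expand m ⟩
  suc m * suc m        ≤⟨ ℕ.*-mono-≤ m<n m<n ⟩
  n * n                ≡⟨ eq ⟩
  m * m + 1            ≡⟨ ℕ.+-identityʳ _ ⟨
  m * m + 1 + 0        ∎)))
  where
  open ℕ.≤-Reasoning
  m<n : m < n
  m<n = m*m<n*n⇒m<n (ℕ.≤-reflexive (trans (ℕ.+-comm 1 (m * m)) (sym eq)))
  expand : ∀ m → m * m + 1 + (m + m) ≡ suc m * suc m
  expand = ℕ-Solver.solve-∀

k*k≡d*[s*s]∧k*k≡d*[t*t]+1⇒k≡1 : ∀ {k d s t} → k * k ≡ d * (s * s) → k * k ≡ d * (t * t) + 1 → k ≡ 1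
k*k≡d*[s*s]∧k*k≡d*[t*t]+1⇒k≡1 {k} {d} {s} {t} k*k≡d*[s*s] k*k≡d*[t*t]+1 =
  ℕ.m*n≡1⇒m≡1 k k (subst (λ t → k * k ≡ t * t + 1) (n*n≡m*m+1⇒m≡0 {t} {k} k*k≡t*t+1) k*k≡t*t+1)
  where
  d≡1 : d ≡ 1
  d≡1 = ∣1⇒≡1 (∣m+n∣m⇒∣n (subst (d ∣_) (trans (sym k*k≡d*[s*s]) k*k≡d*[t*t]+1) (m∣m*n (s * s)))
                          (m∣m*n (t * t)))
  k*k≡t*t+1 : k * k ≡ t * t + 1
  k*k≡t*t+1 = trans (subst (λ e → k * k ≡ e * (t * t) + 1) d≡1 k*k≡d*[t*t]+1)
                    (cong (_+ 1) (ℕ.*-identityˡ (t * t)))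

-- slot k m = k + m whenever ∣ m ∣ ≤ k.
slot : ℕ → ℤ → ℕ
slot k (+ n)     = k + n
slot k -[1+ n ] = k ∸ suc n

data Admissible (k : ℕ) : ℤ → Sign → Set where
  nonneg : ∀ {m} → ∣ m ∣ ≤ k → Admissible k m Sign.+
  neg    : ∀ {m} → ∣ m ∣ < k → Admissible k m Sign.-

-- Admissible pairs with sign + fill the slots 0 … 2k, those with sign - the slots 2k+1 … 4k-1.
index : ℕ → ℤ → Sign → ℕ
index k m Sign.+ = slot k m
index k m Sign.- = k + k + slot k m

module _ {k : ℕ} where

  slot-[1+n]<k : ∀ n → suc n ≤ k → slot k -[1+ n ] < k
  slot-[1+n]<k _ = ℕ.∸-monoʳ-< (s≤s z≤n)

  slot-injective : ∀ i j → ∣ i ∣ ≤ k → ∣ j ∣ ≤ k → slot k i ≡ slot k j → i ≡ j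
  slot-injective (+ _)      (+ _)      _ _ eq = cong +_ (ℕ.+-cancelˡ-≡ k _ _ eq)
  slot-injective -[1+ _ ]   -[1+ _ ]   p q eq = cong -[1+_] (ℕ.suc-injective (ℕ.∸-cancelˡ-≡ p q eq))
  slot-injective (+ m)      -[1+ n ]   _ q eq =
    contradiction (sym eq) (ℕ.<⇒≢ (ℕ.<-≤-trans (slot-[1+n]<k n q) (ℕ.m≤m+n k m)))
  slot-injective -[1+ m ]   (+ n)      p _ eq =
    contradiction eq (ℕ.<⇒≢ (ℕ.<-≤-trans (slot-[1+n]<k m p) (ℕ.m≤m+n k n)))

  slot≤k+k : ∀ i → ∣ i ∣ ≤ k → slot k i ≤ k + k
  slot≤k+k (+ _)      p = ℕ.+-monoʳ-≤ k p
  slot≤k+k -[1+ n ]   _ = ℕ.≤-trans (ℕ.m∸n≤m k (suc n)) (ℕ.m≤m+n k k)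

  slot<k+k : ∀ i → ∣ i ∣ < k → slot k i < k + k
  slot<k+k (+ _)      p = ℕ.+-monoʳ-< k p
  slot<k+k -[1+ n ]   p = ℕ.<-≤-trans (slot-[1+n]<k n (ℕ.<⇒≤ p)) (ℕ.m≤m+n k k)

  0<slot : ∀ i → ∣ i ∣ < k → 0 < slot k i
  0<slot (+ n)      p = ℕ.<-≤-trans (ℕ.≤-<-trans z≤n p) (ℕ.m≤m+n k n)
  0<slot -[1+ _ ]   p = ℕ.m<n⇒0<n∸m p

  index<4k : ∀ {m s} .{{_ : NonZero k}} → Admissible k m s → index k m s < k + k + (k + k)
  index<4k (nonneg {m} p) =
    ℕ.≤-<-trans (slot≤k+k m p) (ℕ.m<m+n (k + k) (ℕ.<-≤-trans (>-nonZero⁻¹ k) (ℕ.m≤m+n k k)))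
  index<4k (neg {m} p)    = ℕ.+-monoʳ-< (k + k) (slot<k+k m p)

  index₊<index₋ : ∀ i j → ∣ i ∣ ≤ k → ∣ j ∣ < k → index k i Sign.+ < index k j Sign.-
  index₊<index₋ i j p q = ℕ.≤-<-trans (slot≤k+k i p) (ℕ.m<m+n (k + k) (0<slot j q))

  index-injective : ∀ {i j s t} → Admissible k i s → Admissible k j t →
                    index k i s ≡ index k j t → i ≡ j × s ≡ t
  index-injective {i} {j} (nonneg p) (nonneg q) eq = slot-injective i j p q eq , refl
  index-injective {i} {j} (neg p)    (neg q)    eq =
    slot-injective i j (ℕ.<⇒≤ p) (ℕ.<⇒≤ q) (ℕ.+-cancelˡ-≡ (k + k) _ _ eq) , refl
  index-injective {i} {j} (nonneg p) (neg q)    eq = contradiction eq (ℕ.<⇒≢ (index₊<index₋ i j p q))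
  index-injective {i} {j} (neg p)    (nonneg q) eq = contradiction (sym eq) (ℕ.<⇒≢ (index₊<index₋ j i q p))

i*i≡+∣i∣*∣i∣ : ∀ i → i *ᶻ i ≡ + (∣ i ∣ * ∣ i ∣)
i*i≡+∣i∣*∣i∣ i = trans (cong (_◃ (∣ i ∣ * ∣ i ∣)) (s*s≡+ (sign i))) (ℤ.+◃n≡+n (∣ i ∣ * ∣ i ∣))

module Geometry (L : IntegralLattice2) where
  gramDet : ℤ
  gramDet = a L *ᶻ c L -ᶻ b L *ᶻ b L

  ⟨_,_⟩ : Vec2 → Vec2 → ℤ
  ⟨ (x , y) , (x′ , y′) ⟩ = (a L *ᶻ x +ᶻ b L *ᶻ y) *ᶻ x′ +ᶻ (b L *ᶻ x +ᶻ c L *ᶻ y) *ᶻ y′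

  det : Vec2 → Vec2 → ℤ
  det (x , y) (x′ , y′) = x *ᶻ y′ -ᶻ y *ᶻ x′

  lagrange-identity : ∀ u v →
    normSq L u *ᶻ normSq L v ≡ ⟨ u , v ⟩ *ᶻ ⟨ u , v ⟩ +ᶻ gramDet *ᶻ (det u v *ᶻ det u v)
  lagrange-identity (x , y) (x′ , y′) = identity (a L) (b L) (c L) x y x′ y′
    where
    identity : ∀ a b c x y x′ y′ →
      let Q = λ x y → a *ᶻ x *ᶻ x +ᶻ (+ 2) *ᶻ b *ᶻ x *ᶻ y +ᶻ c *ᶻ y *ᶻ y
          B = (a *ᶻ x +ᶻ b *ᶻ y) *ᶻ x′ +ᶻ (b *ᶻ x +ᶻ c *ᶻ y) *ᶻ y′
          D = x *ᶻ y′ -ᶻ y *ᶻ x′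
      in Q x y *ᶻ Q x′ y′ ≡ B *ᶻ B +ᶻ (a *ᶻ c -ᶻ b *ᶻ b) *ᶻ (D *ᶻ D)
    identity = ℤ-Solver.solve-∀

  ⟨,⟩-det-injective : ∀ u {v w} .{{_ : NonZeroᶻ (normSq L u)}} →
                      ⟨ u , v ⟩ ≡ ⟨ u , w ⟩ → det u v ≡ det u w → v ≡ w
  ⟨,⟩-det-injective u@(x , y) {v@(x₁ , y₁)} {w@(x₂ , y₂)} ⟨u,v⟩≡⟨u,w⟩ det≡det = cong₂ _,_
    (ℤ.*-cancelˡ-≡ (normSq L u) x₁ x₂ (begin
      normSq L u *ᶻ x₁                       ≡⟨ first x₁ y₁ ⟩
      ⟨ u , v ⟩ *ᶻ x -ᶻ q *ᶻ det u v         ≡⟨ cong₂ (λ m t → m *ᶻ x -ᶻ q *ᶻ t) ⟨u,v⟩≡⟨u,w⟩ det≡det ⟩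
      ⟨ u , w ⟩ *ᶻ x -ᶻ q *ᶻ det u w         ≡⟨ first x₂ y₂ ⟨
      normSq L u *ᶻ x₂                       ∎))
    (ℤ.*-cancelˡ-≡ (normSq L u) y₁ y₂ (begin
      normSq L u *ᶻ y₁                       ≡⟨ second x₁ y₁ ⟩
      p *ᶻ det u v +ᶻ ⟨ u , v ⟩ *ᶻ y         ≡⟨ cong₂ (λ m t → p *ᶻ t +ᶻ m *ᶻ y) ⟨u,v⟩≡⟨u,w⟩ det≡det ⟩
      p *ᶻ det u w +ᶻ ⟨ u , w ⟩ *ᶻ y         ≡⟨ second x₂ y₂ ⟨
      normSq L u *ᶻ y₂                       ∎))
    where
    open ≡-Reasoning
    p q : ℤ
    p = a L *ᶻ x +ᶻ b L *ᶻ y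
    q = b L *ᶻ x +ᶻ c L *ᶻ y

    first : ∀ x′ y′ → normSq L u *ᶻ x′ ≡ ⟨ u , (x′ , y′) ⟩ *ᶻ x -ᶻ q *ᶻ det u (x′ , y′)
    first = identity (a L) (b L) (c L) x y
      where
      identity : ∀ a b c x y x′ y′ →
        let p = a *ᶻ x +ᶻ b *ᶻ y
            q = b *ᶻ x +ᶻ c *ᶻ y
        in (a *ᶻ x *ᶻ x +ᶻ (+ 2) *ᶻ b *ᶻ x *ᶻ y +ᶻ c *ᶻ y *ᶻ y) *ᶻ x′
           ≡ (p *ᶻ x′ +ᶻ q *ᶻ y′) *ᶻ x -ᶻ q *ᶻ (x *ᶻ y′ -ᶻ y *ᶻ x′)
      identity = ℤ-Solver.solve-∀

    second : ∀ x′ y′ → normSq L u *ᶻ y′ ≡ p *ᶻ det u (x′ , y′) +ᶻ ⟨ u , (x′ , y′) ⟩ *ᶻ y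
    second = identity (a L) (b L) (c L) x y
      where
      identity : ∀ a b c x y x′ y′ →
        let p = a *ᶻ x +ᶻ b *ᶻ y
            q = b *ᶻ x +ᶻ c *ᶻ y
        in (a *ᶻ x *ᶻ x +ᶻ (+ 2) *ᶻ b *ᶻ x *ᶻ y +ᶻ c *ᶻ y *ᶻ y) *ᶻ y′
           ≡ p *ᶻ (x *ᶻ y′ -ᶻ y *ᶻ x′) +ᶻ (p *ᶻ x′ +ᶻ q *ᶻ y′) *ᶻ y
      identity = ℤ-Solver.solve-∀

module Circle (L : IntegralLattice2) {k : ℕ} .{{_ : NonZero k}} (u : Vec2) (∥u∥²≡k : normSq L u ≡ + k) where
  open Geometry L

  d : ℕ
  d = ∣ gramDet ∣

  gramDet≡+d : gramDet ≡ + d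
  gramDet≡+d = sym (ℤ.0≤i⇒+∣i∣≡i (ℤ.<⇒≤ (det-pos L)))

  0<d : 0 < d
  0<d = ℤ.drop‿+<+ (subst (0ℤ <ᶻ_) gramDet≡+d (det-pos L))

  circle-equation : ∀ {v} → normSq L v ≡ + k →
    ∣ ⟨ u , v ⟩ ∣ * ∣ ⟨ u , v ⟩ ∣ + d * (∣ det u v ∣ * ∣ det u v ∣) ≡ k * k
  circle-equation {v} ∥v∥²≡k = ℤ.+-injective (begin
    + (m * m + d * (t * t))                             ≡⟨ ℤ.pos-+ (m * m) (d * (t * t)) ⟩
    + (m * m) +ᶻ + (d * (t * t))                        ≡⟨ cong (+ (m * m) +ᶻ_) (ℤ.pos-* d (t * t)) ⟩
    + (m * m) +ᶻ + d *ᶻ + (t * t)                       ≡⟨ cong₂ (λ x y → x +ᶻ y *ᶻ + (t * t))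
                                                                 (i*i≡+∣i∣*∣i∣ ⟨ u , v ⟩) gramDet≡+d ⟨
    ⟨ u , v ⟩ *ᶻ ⟨ u , v ⟩ +ᶻ gramDet *ᶻ + (t * t)      ≡⟨ cong (λ x → ⟨ u , v ⟩ *ᶻ ⟨ u , v ⟩ +ᶻ gramDet *ᶻ x)
                                                                (i*i≡+∣i∣*∣i∣ (det u v)) ⟨
    ⟨ u , v ⟩ *ᶻ ⟨ u , v ⟩ +ᶻ gramDet *ᶻ (det u v *ᶻ det u v)
                                                        ≡⟨ lagrange-identity u v ⟨
    normSq L u *ᶻ normSq L v                            ≡⟨ cong₂ _*ᶻ_ ∥u∥²≡k ∥v∥²≡k ⟩
    + k *ᶻ + k                                          ≡⟨ ℤ.pos-* k k ⟨
    + (k * k)                                           ∎)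
    where
    open ≡-Reasoning
    m = ∣ ⟨ u , v ⟩ ∣
    t = ∣ det u v ∣

  ∣⟨u,v⟩∣≤k : ∀ {v} → normSq L v ≡ + k → ∣ ⟨ u , v ⟩ ∣ ≤ k
  ∣⟨u,v⟩∣≤k {v} ∥v∥²≡k = m*m≤n*n⇒m≤n {∣ ⟨ u , v ⟩ ∣}
    (subst (∣ ⟨ u , v ⟩ ∣ * ∣ ⟨ u , v ⟩ ∣ ≤_) (circle-equation ∥v∥²≡k) (ℕ.m≤m+n _ _))

  0<∣det∣⇒∣⟨u,v⟩∣<k : ∀ {v} → normSq L v ≡ + k → 0 < ∣ det u v ∣ → ∣ ⟨ u , v ⟩ ∣ < k
  0<∣det∣⇒∣⟨u,v⟩∣<k {v} ∥v∥²≡k 0<t = m*m<n*n⇒m<n {∣ ⟨ u , v ⟩ ∣}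
    (subst (∣ ⟨ u , v ⟩ ∣ * ∣ ⟨ u , v ⟩ ∣ <_) (circle-equation ∥v∥²≡k)
      (ℕ.m<m+n _ (ℕ.*-mono-< 0<d (ℕ.*-mono-< 0<t 0<t))))

  admissible : ∀ {v} → normSq L v ≡ + k → Admissible k ⟨ u , v ⟩ (sign (det u v))
  admissible {v} ∥v∥²≡k with det u v in det≡
  ... | + _      = nonneg (∣⟨u,v⟩∣≤k ∥v∥²≡k)
  ... | -[1+ _ ] = neg (0<∣det∣⇒∣⟨u,v⟩∣<k ∥v∥²≡k (subst (λ i → 0 < ∣ i ∣) (sym det≡) z<s))

  ∣det∣-determined : ∀ {v w} → normSq L v ≡ + k → normSq L w ≡ + k →
                     ⟨ u , v ⟩ ≡ ⟨ u , w ⟩ → ∣ det u v ∣ ≡ ∣ det u w ∣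
  ∣det∣-determined {v} {w} ∥v∥²≡k ∥w∥²≡k ⟨u,v⟩≡⟨u,w⟩ =
    m*m≡n*n⇒m≡n (ℕ.*-cancelˡ-≡ _ _ d {{>-nonZero 0<d}} (ℕ.+-cancelˡ-≡ (m * m) _ _ (begin
      m * m + d * (∣ det u v ∣ * ∣ det u v ∣)                          ≡⟨ circle-equation ∥v∥²≡k ⟩
      k * k                                                            ≡⟨ circle-equation ∥w∥²≡k ⟨
      ∣ ⟨ u , w ⟩ ∣ * ∣ ⟨ u , w ⟩ ∣ + d * (∣ det u w ∣ * ∣ det u w ∣)  ≡⟨ cong (λ i → ∣ i ∣ * ∣ i ∣ + _)
                                                                               ⟨u,v⟩≡⟨u,w⟩ ⟨
      m * m + d * (∣ det u w ∣ * ∣ det u w ∣)                          ∎)))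
    where
    open ≡-Reasoning
    m = ∣ ⟨ u , v ⟩ ∣

  on-circle-determined : ∀ {v w} → normSq L v ≡ + k → normSq L w ≡ + k →
    ⟨ u , v ⟩ ≡ ⟨ u , w ⟩ → sign (det u v) ≡ sign (det u w) → v ≡ w
  on-circle-determined {v} {w} ∥v∥²≡k ∥w∥²≡k ⟨u,v⟩≡⟨u,w⟩ sign≡ =
    ⟨,⟩-det-injective u {{subst NonZeroᶻ (sym ∥u∥²≡k) it}} ⟨u,v⟩≡⟨u,w⟩
      (ℤ.◃-cong sign≡ (∣det∣-determined {v} {w} ∥v∥²≡k ∥w∥²≡k ⟨u,v⟩≡⟨u,w⟩))

  ⟨u,v⟩≡0∧⟨u,w⟩≡1⇒k≡1 : ∀ {v w} → normSq L v ≡ + k → normSq L w ≡ + k →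
                        ⟨ u , v ⟩ ≡ 0ℤ → ⟨ u , w ⟩ ≡ 1ℤ → k ≡ 1
  ⟨u,v⟩≡0∧⟨u,w⟩≡1⇒k≡1 {v} {w} ∥v∥²≡k ∥w∥²≡k ⟨u,v⟩≡0 ⟨u,w⟩≡1 =
    k*k≡d*[s*s]∧k*k≡d*[t*t]+1⇒k≡1 {k} {d} {s} {t}
      (sym (trans (cong (λ i → ∣ i ∣ * ∣ i ∣ + d * (s * s)) (sym ⟨u,v⟩≡0)) (circle-equation ∥v∥²≡k)))
      (trans (sym (circle-equation ∥w∥²≡k))
             (trans (cong (λ i → ∣ i ∣ * ∣ i ∣ + d * (t * t)) ⟨u,w⟩≡1) (ℕ.+-comm 1 (d * (t * t)))))
    where
    s = ∣ det u v ∣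
    t = ∣ det u w ∣

  module _ {l : List Vec2} (on-circle : ∀ {v} → v ∈ l → normSq L v ≡ + k) where

    inner-product-gap : 2 ≤ k → ∃[ m₀ ] (m₀ ≤ 1 × ∀ {v} → v ∈ l → ⟨ u , v ⟩ ≢ + m₀)
    inner-product-gap 2≤k with any? (λ v → ⟨ u , v ⟩ ≟ᶻ 0ℤ) l
    ... | yes ∃v = 1 , ℕ.≤-refl , λ w∈l ⟨u,w⟩≡1 →
      ℕ.<⇒≢ 2≤k (sym (⟨u,v⟩≡0∧⟨u,w⟩≡1⇒k≡1 (on-circle v∈l) (on-circle w∈l) ⟨u,v⟩≡0 ⟨u,w⟩≡1))
      where
      v∈l = proj₁ (proj₂ (find ∃v))
      ⟨u,v⟩≡0 = proj₂ (proj₂ (find ∃v))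
    ... | no ∄v = 0 , z≤n , λ v∈l ⟨u,v⟩≡0 → ∄v (lose v∈l ⟨u,v⟩≡0)

    length<4k : ∀ {m₀} → Unique l → m₀ ≤ k → (∀ {v} → v ∈ l → ⟨ u , v ⟩ ≢ + m₀) →
                length l < k + k + (k + k)
    length<4k {m₀} l! m₀≤k gap = injection-missing-value⇒length< code l! code-injective
      (λ v∈l → index<4k (admissible (on-circle v∈l)))
      (index<4k (nonneg {m = + m₀} m₀≤k))
      (λ v∈l code≡ → gap v∈l (proj₁ (index-injective (admissible (on-circle v∈l)) (nonneg m₀≤k) code≡)))
      where
      code : Vec2 → ℕ
      code v = index k ⟨ u , v ⟩ (sign (det u v))

      code-injective : InjectiveOn l code
      code-injective v∈l w∈l code≡ =
        let ⟨u,v⟩≡⟨u,w⟩ , sign≡ = index-injective (admissible (on-circle v∈l)) (admissible (on-circle w∈l)) code≡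
        in on-circle-determined (on-circle v∈l) (on-circle w∈l) ⟨u,v⟩≡⟨u,w⟩ sign≡

nC[n∸1]≡n : ∀ n .{{_ : NonZero n}} → n C (n ∸ 1) ≡ n
nC[n∸1]≡n (suc n) = begin
  suc n C n            ≡⟨ nCk≡nC[n∸k] (ℕ.n≤1+n n) ⟩
  suc n C (suc n ∸ n)  ≡⟨ cong (suc n C_) (ℕ.m+n∸n≡m 1 n) ⟩
  suc n C 1            ≡⟨ nC1≡n (suc n) ⟩
  suc n                ∎
  where open ≡-Reasoning

N=⇒<4k : ∀ {k n} → 2 ≤ k → (L : IntegralLattice2) → N= L k n → n < k + k + (k + k)
N=⇒<4k {suc _} 2≤k L ([] , _ , refl , _) = s≤s z≤n
N=⇒<4k {k@(suc _)} 2≤k L (u ∷ l , l! , refl , l≡circle) =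
  let m₀ , m₀≤1 , gap = inner-product-gap on-circle 2≤k
  in length<4k on-circle l! (ℕ.≤-trans m₀≤1 (ℕ.≤-trans (ℕ.n≤1+n 1) 2≤k)) gap
  where
  on-circle : ∀ {v} → v ∈ u ∷ l → normSq L v ≡ + k
  on-circle = Equivalence.to (l≡circle _)
  open Circle L u (on-circle (here refl))

lemma4p3 : (k : ℕ) → 2 ≤ k → (L : IntegralLattice2) →
    ¬ N= L k (2 * ((2 * k) C (2 * k ∸ 1)))
lemma4p3 k@(suc _) 2≤k L N=L = ℕ.<-irrefl count≡4k (N=⇒<4k 2≤k L N=L)
  where
  count≡4k : 2 * ((2 * k) C (2 * k ∸ 1)) ≡ k + k + (k + k)
  count≡4k = trans (cong (2 *_) (nC[n∸1]≡n (2 * k))) (double-double k)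
    where
    double-double : ∀ k → 2 * (2 * k) ≡ k + k + (k + k)
    double-double = ℕ-Solver.solve-∀
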